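{- Let $G$ be a finite connected simple graph with $n$ vertices and $m$ edges, and let $B$ be its non-backtracking matrix. Let $R$ be a $2m\times 2(m-n)$ matrix with linearly independent columns, where the first $m-n$ columns of $R$ are taken from $\mathscr{E}_{ -1}\cap\operatorname{Null}(ST)$ and the remaining $m-n$ columns are taken from $\mathscr{E}_{1}\cap\operatorname{Null}(ST)$. Let $X=\begin{bmatrix}S&T^T&R\end{bmatrix}$. Then \[BX=X\begin{bmatrix}K&0&0\\0&I_{m-n}&0\\0&0&-I_{m-n}\end{bmatrix}.\]
   Context: Replace each edge $\{u,v\}$ of $G$ by the two directed edges $(u,v),(v,u)$. The non-backtracking matrix $B$ is the $2m\times 2m$ matrix indexed by directed edges with $B((u,v),(x,y))=1$ if $v=x$ and $u\neq y$, and $0$ otherwise. $A$ is the adjacency matrix and $D$ the diagonal degree matrix of $G$, and $K=\begin{bmatrix}A&D-I\\-I&0\end{bmatrix}$ ($2n\times 2n$). $S$ is the $2m\times n$ matrix with $S((u,v),x)=1$ if $v=x$ and $0$ otherwise; $T$ is the $n\times 2m$ matrix with $T(x,(u,v))=1$ if $x=u$ and $0$ otherwise. $\tau$ is the $2m\times 2m$ matrix with $\tau((u,v),(x,y))=1$ if $v=x$ and $u=y$, and $0$ otherwise (it maps each directed edge to its reversal). $\mathscr{E}_{\pm1}$ denotes the eigenspace of $\tau$ for the eigenvalue $\pm1$, and $\operatorname{Null}(ST)$ the null space of $ST$. -}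

module Defs where

open import Level using (Level)
open import Algebra.Bundles using (CommutativeRing)
open import Data.Nat using (ℕ; _+_; _∸_)
open import Data.Fin using (Fin; splitAt; _≟_)
open import Data.Product using (_×_; _,_; proj₁; proj₂; ∃)
open import Data.Sum using (_⊎_; inj₁; inj₂)
open import Data.Bool using (Bool; if_then_else_; _∧_; not)
open import Relation.Nullary using (¬_)
open import Relation.Nullary.Decidable using (⌊_⌋)
open import Relation.Binary.PropositionalEquality using (_≡_; _≢_)

-- Finite simple graphs with n vertices (Fin n) and m edges (Fin m).
-- Edge i is the unordered pair {proj₁ (edge i), proj₂ (edge i)}; the
-- chosen orientation is arbitrary.

record Graph (n m : ℕ) : Set where
  field
    edge      : Fin m → Fin n × Fin n
    loopless  : ∀ i → proj₁ (edge i) ≢ proj₂ (edge i)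
    -- no multiple edges: distinct indices give distinct unordered pairs
    distinct  : ∀ i j → edge i ≡ edge j → i ≡ j
    distinct′ : ∀ i j → edge i ≡ (proj₂ (edge j) , proj₁ (edge j)) → i ≡ j

module _ {n m : ℕ} (G : Graph n m) where
  open Graph G

  Adjacent : Fin n → Fin n → Set
  Adjacent u v = ∃ λ i → (edge i ≡ (u , v)) ⊎ (edge i ≡ (v , u))

  data Reachable (u : Fin n) : Fin n → Set where
    here : Reachable u u
    step : ∀ {v w} → Reachable u v → Adjacent v w → Reachable u w

  Connected : Set
  Connected = ∀ u v → Reachable u v

  -- Directed edges are indexed by Fin (m + m): index (inj₁ i) of
  -- splitAt is edge i in its chosen orientation (u,v), index (inj₂ i)
  -- is its reversal (v,u).
  arc : Fin (m + m) → Fin n × Fin n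
  arc e with splitAt m e
  ... | inj₁ i = edge i
  ... | inj₂ i = proj₂ (edge i) , proj₁ (edge i)

  tail head : Fin (m + m) → Fin n
  tail e = proj₁ (arc e)
  head e = proj₂ (arc e)

module Mat {c ℓ : Level} (𝕂 : CommutativeRing c ℓ) where
  open CommutativeRing 𝕂 hiding (_+_)
  open CommutativeRing 𝕂 using () renaming (_+_ to _+ᵣ_)
  open import Algebra.Properties.CommutativeMonoid.Sum +-commutativeMonoid using (sum)

  Matrix : ℕ → ℕ → Set c
  Matrix r s = Fin r → Fin s → Carrier


  _⊗_ : ∀ {r s t} → Matrix r s → Matrix s t → Matrix r t
  (M ⊗ N) i k = sum (λ j → M i j * N j k)

  _≋_ : ∀ {r s} → Matrix r s → Matrix r s → Set ℓ
  M ≋ N = ∀ i j → M i j ≈ N i j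

  ind : Bool → Carrier
  ind b = if b then 1# else 0#

  δ : ∀ {k} → Fin k → Fin k → Carrier
  δ i j = ind ⌊ i ≟ j ⌋

  I : ∀ {k} → Matrix k k
  I = δ

  0M : ∀ {r s} → Matrix r s
  0M _ _ = 0#

  -ᴹ_ : ∀ {r s} → Matrix r s → Matrix r s
  (-ᴹ M) i j = - (M i j)

  _−ᴹ_ : ∀ {r s} → Matrix r s → Matrix r s → Matrix r s
  (M −ᴹ N) i j = M i j - N i j

  transpose : ∀ {r s} → Matrix r s → Matrix s r
  transpose M i j = M j i

  block2 : ∀ {r₁ r₂ s₁ s₂} → Matrix r₁ s₁ → Matrix r₁ s₂ →
           Matrix r₂ s₁ → Matrix r₂ s₂ → Matrix (r₁ + r₂) (s₁ + s₂)
  block2 {r₁} {r₂} {s₁} {s₂} P Q U V i j with splitAt r₁ i | splitAt s₁ j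
  ... | inj₁ a | inj₁ b = P a b
  ... | inj₁ a | inj₂ b = Q a b
  ... | inj₂ a | inj₁ b = U a b
  ... | inj₂ a | inj₂ b = V a b

  hcat : ∀ {r s₁ s₂} → Matrix r s₁ → Matrix r s₂ → Matrix r (s₁ + s₂)
  hcat {s₁ = s₁} P Q i j with splitAt s₁ j
  ... | inj₁ b = P i b
  ... | inj₂ b = Q i b

  diag2 : ∀ {r s} → Matrix r r → Matrix s s → Matrix (r + s) (r + s)
  diag2 P Q = block2 P 0M 0M Q

  Col : ℕ → Set c
  Col k = Fin k → Carrier

  _▸_ : ∀ {r s} → Matrix r s → Col s → Col r
  (M ▸ v) i = sum (λ j → M i j * v j)

  column : ∀ {r s} → Matrix r s → Fin s → Col r
  column M j i = M i j

  LinearlyIndependentColumns : ∀ {r s} → Matrix r s → Set (c Level.⊔ ℓ)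
  LinearlyIndependentColumns M =
    ∀ (a : Col _) → (∀ i → (M ▸ a) i ≈ 0#) → ∀ j → a j ≈ 0#

  module GraphMatrices {n m : ℕ} (G : Graph n m) where

    B : Matrix (m + m) (m + m)
    B e f = ind (⌊ head G e ≟ tail G f ⌋ ∧ not ⌊ tail G e ≟ head G f ⌋)

    A : Matrix n n
    A x y = sum (λ e → δ (tail G e) x * δ (head G e) y)

    deg : Fin n → Carrier
    deg x = sum (λ e → δ (tail G e) x)

    D : Matrix n n
    D x y = δ x y * deg x

    K : Matrix (n + n) (n + n)
    K = block2 A (D −ᴹ I) (-ᴹ I) 0M

    S : Matrix (m + m) n
    S e x = δ (head G e) x

    T : Matrix n (m + m)
    T x e = δ x (tail G e)

    τ : Matrix (m + m) (m + m)
    τ e f = ind (⌊ head G e ≟ tail G f ⌋ ∧ ⌊ tail G e ≟ head G f ⌋)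

    ST : Matrix (m + m) (m + m)
    ST = S ⊗ T

    InEigenspaceτ : Carrier → Col (m + m) → Set ℓ
    InEigenspaceτ λ′ v = ∀ e → (τ ▸ v) e ≈ λ′ * v e

    InNullST : Col (m + m) → Set ℓ
    InNullST v = ∀ e → (ST ▸ v) e ≈ 0#

module Submission where

-- Write h, t for the head and tail of a directed edge. Then (ST)(e,f) = [h e = t f], and
-- since G is simple τ(e,f) = [f is the reversal of e], so the non-backtracking condition says
-- exactly B = ST − τ. As TS = A, TTᵀ = D and τ exchanges S and Tᵀ, this gives BS = SA − Tᵀ and
-- BTᵀ = SD − S, the first 2n columns of [S Tᵀ] K. For v ∈ 𝓔_λ ∩ Null(ST) it gives
-- Bv = 0 − τv = −λv, which accounts for the columns of R.

open import Defs
open import Level using (Level)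
open import Algebra.Bundles using (CommutativeRing)
open import Data.Nat using (ℕ; _+_; _∸_; zero; suc)
open import Data.Fin using (Fin; _↑ˡ_; _↑ʳ_; splitAt; join; zero; suc)
open import Data.Fin.Properties using (_≟_; splitAt-↑ˡ; splitAt-↑ʳ; splitAt⁻¹-↑ˡ; splitAt⁻¹-↑ʳ; splitAt-join; join-splitAt)
open import Data.Product using (_×_; _,_; proj₁; proj₂)
import Data.Product as Product
open import Data.Sum using (inj₁; inj₂; _⊎_)
import Data.Sum as Sum
open import Data.Empty using (⊥-elim)
open import Relation.Nullary using (yes; no)
open import Relation.Binary.Bundles using (Setoid)
open import Relation.Binary.PropositionalEquality as ≡ using (_≡_; _≢_; cong; cong₂)
import Relation.Binary.Reasoning.Setoid as SetoidReasoning

module MatrixProperties {c ℓ : Level} (𝕂 : CommutativeRing c ℓ) where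
  open Mat 𝕂
  open CommutativeRing 𝕂 hiding (zero) renaming (_+_ to _+ᵣ_)
  open import Algebra.Properties.Semiring.Sum semiring using (sum; sum-cong-≋; sum-replicate-zero; ∑-distrib-+; *-distribˡ-sum)
  open import Algebra.Properties.Ring ring using (-1*x≈-x; -‿distribˡ-*; -‿distribʳ-*)

  module ≈-Reasoning = SetoidReasoning setoid

  ≋-setoid : ℕ → ℕ → Setoid c ℓ
  ≋-setoid r s = record
    { Carrier       = Matrix r s
    ; _≈_           = _≋_
    ; isEquivalence = record
      { refl  = λ _ _ → refl
      ; sym   = λ p i j → sym (p i j)
      ; trans = λ p q i j → trans (p i j) (q i j)
      }
    }

  module ≋-Reasoning {r s : ℕ} = SetoidReasoning (≋-setoid r s)

  ≋-refl : ∀ {r s} {M : Matrix r s} → M ≋ M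
  ≋-refl _ _ = refl

  ≋-sym : ∀ {r s} {M N : Matrix r s} → M ≋ N → N ≋ M
  ≋-sym M≋N i j = sym (M≋N i j)

  infixl 6 _⊕_
  _⊕_ : ∀ {r s} → Matrix r s → Matrix r s → Matrix r s
  (M ⊕ N) i j = M i j +ᵣ N i j

  select : ∀ {r s} → (Fin r → Fin s) → Matrix r s
  select f i j = δ (f i) j

  leftCols : ∀ {r s₁ s₂} → Matrix r (s₁ + s₂) → Matrix r s₁
  leftCols {s₂ = s₂} M i j = M i (j ↑ˡ s₂)

  rightCols : ∀ {r s₁ s₂} → Matrix r (s₁ + s₂) → Matrix r s₂
  rightCols {s₁ = s₁} M i j = M i (s₁ ↑ʳ j)

  topRows : ∀ {r₁ r₂ s} → Matrix (r₁ + r₂) s → Matrix r₁ s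
  topRows {r₂ = r₂} M i j = M (i ↑ˡ r₂) j

  bottomRows : ∀ {r₁ r₂ s} → Matrix (r₁ + r₂) s → Matrix r₂ s
  bottomRows {r₁ = r₁} M i j = M (r₁ ↑ʳ i) j

  δ-refl : ∀ {k} (i : Fin k) → δ i i ≈ 1#
  δ-refl i with i ≟ i
  ... | yes _ = refl
  ... | no i≢i = ⊥-elim (i≢i ≡.refl)

  δ-≢ : ∀ {k} {i j : Fin k} → i ≢ j → δ i j ≡ 0#
  δ-≢ {i = i} {j} i≢j with i ≟ j
  ... | yes i≡j = ⊥-elim (i≢j i≡j)
  ... | no _    = ≡.refl

  δ-sym : ∀ {k} (i j : Fin k) → δ i j ≈ δ j i
  δ-sym i j with i ≟ j | j ≟ i
  ... | yes _   | yes _   = refl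
  ... | no _    | no _    = refl
  ... | yes i≡j | no j≢i  = ⊥-elim (j≢i (≡.sym i≡j))
  ... | no i≢j  | yes j≡i = ⊥-elim (i≢j (≡.sym j≡i))

  δ-*-δ : ∀ {k} (x y a : Fin k) → δ x a * δ y a ≈ δ x y * δ a x
  δ-*-δ x y a with x ≟ a
  ... | no x≢a     = trans (zeroˡ _) (sym (trans (*-congˡ (reflexive (δ-≢ (λ a≡x → x≢a (≡.sym a≡x))))) (zeroʳ _)))
  ... | yes ≡.refl = trans (*-identityˡ _) (trans (δ-sym y x) (sym (trans (*-congˡ (δ-refl x)) (*-identityʳ _))))

  δ-suc : ∀ {k} (i j : Fin k) → δ (suc i) (suc j) ≡ δ i j
  δ-suc i j with i ≟ j
  ... | yes _ = ≡.refl
  ... | no _  = ≡.refl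

  sum-zero : ∀ {k} {w : Col k} → (∀ j → w j ≈ 0#) → sum w ≈ 0#
  sum-zero {k} w≈0 = trans (sum-cong-≋ w≈0) (sum-replicate-zero k)

  sum-δˡ : ∀ {k} (i : Fin k) (v : Col k) → sum (λ j → δ i j * v j) ≈ v i
  sum-δˡ {suc k} zero v = begin
    1# * v zero +ᵣ sum (λ j → 0# * v (suc j)) ≈⟨ +-cong (*-identityˡ _) (sum-zero (λ j → zeroˡ (v (suc j)))) ⟩
    v zero +ᵣ 0#                              ≈⟨ +-identityʳ _ ⟩
    v zero                                    ∎
    where open ≈-Reasoning
  sum-δˡ {suc k} (suc i) v = begin
    0# * v zero +ᵣ sum (λ j → δ (suc i) (suc j) * v (suc j))
      ≈⟨ +-cong (zeroˡ _) (sum-cong-≋ (λ j → *-congʳ (reflexive (δ-suc i j)))) ⟩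
    0# +ᵣ sum (λ j → δ i j * v (suc j)) ≈⟨ +-identityˡ _ ⟩
    sum (λ j → δ i j * v (suc j))       ≈⟨ sum-δˡ i (λ j → v (suc j)) ⟩
    v (suc i)                           ∎
    where open ≈-Reasoning

  sum-δʳ : ∀ {k} (i : Fin k) (v : Col k) → sum (λ j → v j * δ j i) ≈ v i
  sum-δʳ i v = trans (sum-cong-≋ (λ j → trans (*-comm _ _) (*-congʳ (δ-sym j i)))) (sum-δˡ i v)

  sum-neg : ∀ {k} (w : Col k) → sum (λ j → - w j) ≈ - sum w
  sum-neg w = begin
    sum (λ j → - w j)      ≈⟨ sum-cong-≋ (λ j → sym (-1*x≈-x (w j))) ⟩
    sum (λ j → - 1# * w j) ≈⟨ *-distribˡ-sum (- 1#) w ⟨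
    - 1# * sum w           ≈⟨ -1*x≈-x _ ⟩
    - sum w                ∎
    where open ≈-Reasoning

  sum-split : ∀ r s (v : Col (r + s)) → sum v ≈ sum (λ i → v (i ↑ˡ s)) +ᵣ sum (λ j → v (r ↑ʳ j))
  sum-split zero    s v = sym (+-identityˡ _)
  sum-split (suc r) s v = trans (+-congˡ (sum-split r s (λ j → v (suc j)))) (sym (+-assoc _ _ _))

  ▸-congˡ : ∀ {r s} {M N : Matrix r s} → M ≋ N → ∀ v i → (M ▸ v) i ≈ (N ▸ v) i
  ▸-congˡ M≋N v i = sum-cong-≋ (λ j → *-congʳ (M≋N i j))

  ▸-distrib-−ᴹ : ∀ {r s} (M N : Matrix r s) v i → ((M −ᴹ N) ▸ v) i ≈ (M ▸ v) i - (N ▸ v) i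
  ▸-distrib-−ᴹ M N v i = begin
    sum (λ j → (M i j - N i j) * v j)         ≈⟨ sum-cong-≋ (λ j → trans (distribʳ (v j) (M i j) (- N i j)) (+-congˡ (sym (-‿distribˡ-* (N i j) (v j))))) ⟩
    sum (λ j → M i j * v j +ᵣ - (N i j * v j)) ≈⟨ ∑-distrib-+ (λ j → M i j * v j) (λ j → - (N i j * v j)) ⟩
    (M ▸ v) i +ᵣ sum (λ j → - (N i j * v j))   ≈⟨ +-congˡ (sum-neg (λ j → N i j * v j)) ⟩
    (M ▸ v) i - (N ▸ v) i                      ∎
    where open ≈-Reasoning

  ⊗-congˡ : ∀ {r s t} {M N : Matrix r s} → M ≋ N → (X : Matrix s t) → (M ⊗ X) ≋ (N ⊗ X)
  ⊗-congˡ M≋N X i j = ▸-congˡ M≋N (column X j) i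

  ⊗-congʳ : ∀ {r s t} (M : Matrix r s) {X Y : Matrix s t} → X ≋ Y → (M ⊗ X) ≋ (M ⊗ Y)
  ⊗-congʳ M X≋Y i j = sum-cong-≋ (λ k → *-congˡ (X≋Y k j))

  ⊗-distribʳ-−ᴹ : ∀ {r s t} (M N : Matrix r s) (X : Matrix s t) → ((M −ᴹ N) ⊗ X) ≋ ((M ⊗ X) −ᴹ (N ⊗ X))
  ⊗-distribʳ-−ᴹ M N X i j = ▸-distrib-−ᴹ M N (column X j) i

  ⊗-zeroʳ : ∀ {r s t} (X : Matrix r s) → (X ⊗ 0M {s} {t}) ≋ 0M
  ⊗-zeroʳ X i j = sum-zero (λ k → zeroʳ (X i k))

  ⊗-identityʳ : ∀ {r s} (X : Matrix r s) → (X ⊗ I) ≋ X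
  ⊗-identityʳ X i j = sum-δʳ j (X i)

  ⊗-neg-identityʳ : ∀ {r s} (X : Matrix r s) → (X ⊗ (-ᴹ I)) ≋ (-ᴹ X)
  ⊗-neg-identityʳ X i j = begin
    sum (λ k → X i k * - δ k j)  ≈⟨ sum-cong-≋ (λ k → sym (-‿distribʳ-* (X i k) (δ k j))) ⟩
    sum (λ k → - (X i k * δ k j)) ≈⟨ sum-neg (λ k → X i k * δ k j) ⟩
    - sum (λ k → X i k * δ k j)   ≈⟨ -‿cong (sum-δʳ j (X i)) ⟩
    - X i j                       ∎
    where open ≈-Reasoning

  select-⊗ : ∀ {r s t} (f : Fin r → Fin s) (X : Matrix s t) → (select f ⊗ X) ≋ (λ i → X (f i))
  select-⊗ f X i j = sum-δˡ (f i) (column X j)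

  −ᴹ-cong : ∀ {r s} {M M′ N N′ : Matrix r s} → M ≋ M′ → N ≋ N′ → (M −ᴹ N) ≋ (M′ −ᴹ N′)
  −ᴹ-cong M≋M′ N≋N′ i j = +-cong (M≋M′ i j) (-‿cong (N≋N′ i j))

  ⊕-cong : ∀ {r s} {M M′ N N′ : Matrix r s} → M ≋ M′ → N ≋ N′ → (M ⊕ N) ≋ (M′ ⊕ N′)
  ⊕-cong M≋M′ N≋N′ i j = +-cong (M≋M′ i j) (N≋N′ i j)

  ⊕-identityʳ : ∀ {r s} (M : Matrix r s) → (M ⊕ 0M) ≋ M
  ⊕-identityʳ M i j = +-identityʳ (M i j)

  ⊕-identityˡ : ∀ {r s} (M : Matrix r s) → (0M ⊕ M) ≋ M
  ⊕-identityˡ M i j = +-identityˡ (M i j)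

  hcat-cong : ∀ {r s₁ s₂} {P P′ : Matrix r s₁} {Q Q′ : Matrix r s₂} →
              P ≋ P′ → Q ≋ Q′ → hcat P Q ≋ hcat P′ Q′
  hcat-cong {s₁ = s₁} P≋P′ Q≋Q′ i j with splitAt s₁ j
  ... | inj₁ a = P≋P′ i a
  ... | inj₂ b = Q≋Q′ i b

  hcat-leftCols-rightCols : ∀ {r s₁ s₂} (M : Matrix r (s₁ + s₂)) →
                            hcat (leftCols {s₁ = s₁} {s₂} M) (rightCols {s₁ = s₁} {s₂} M) ≋ M
  hcat-leftCols-rightCols {s₁ = s₁} {s₂} M i j with splitAt s₁ j in eq
  ... | inj₁ a = reflexive (cong (M i) (splitAt⁻¹-↑ˡ eq))
  ... | inj₂ b = reflexive (cong (M i) (splitAt⁻¹-↑ʳ eq))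

  hcat-⊕ : ∀ {r s₁ s₂} (P P′ : Matrix r s₁) (Q Q′ : Matrix r s₂) →
           (hcat P Q ⊕ hcat P′ Q′) ≋ hcat (P ⊕ P′) (Q ⊕ Q′)
  hcat-⊕ {s₁ = s₁} P P′ Q Q′ i j with splitAt s₁ j
  ... | inj₁ _ = refl
  ... | inj₂ _ = refl

  ⊗-hcat : ∀ {r s t₁ t₂} (M : Matrix r s) (P : Matrix s t₁) (Q : Matrix s t₂) →
           (M ⊗ hcat P Q) ≋ hcat (M ⊗ P) (M ⊗ Q)
  ⊗-hcat {t₁ = t₁} M P Q i j with splitAt t₁ j
  ... | inj₁ _ = refl
  ... | inj₂ _ = refl

  hcat-⊗ : ∀ {r s₁ s₂ t} (P : Matrix r s₁) (Q : Matrix r s₂) (N : Matrix (s₁ + s₂) t) →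
           (hcat P Q ⊗ N) ≋ ((P ⊗ topRows {s₁} {s₂} N) ⊕ (Q ⊗ bottomRows {s₁} {s₂} N))
  hcat-⊗ {s₁ = s₁} {s₂} P Q N i j = trans (sum-split s₁ s₂ _) (+-cong
    (sum-cong-≋ (λ a → *-congʳ (reflexive (hcat-↑ˡ a))))
    (sum-cong-≋ (λ b → *-congʳ (reflexive (hcat-↑ʳ b)))))
    where
    hcat-↑ˡ : ∀ a → hcat P Q i (a ↑ˡ s₂) ≡ P i a
    hcat-↑ˡ a rewrite splitAt-↑ˡ s₁ a s₂ = ≡.refl
    hcat-↑ʳ : ∀ b → hcat P Q i (s₁ ↑ʳ b) ≡ Q i b
    hcat-↑ʳ b rewrite splitAt-↑ʳ s₁ s₂ b = ≡.refl

  module _ {r₁ r₂ s₁ s₂} (U : Matrix r₁ s₁) (V : Matrix r₁ s₂) (W : Matrix r₂ s₁) (Z : Matrix r₂ s₂) where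

    topRows-block2 : topRows {r₁} {r₂} (block2 U V W Z) ≋ hcat U V
    topRows-block2 a j rewrite splitAt-↑ˡ r₁ a r₂ with splitAt s₁ j
    ... | inj₁ _ = refl
    ... | inj₂ _ = refl

    bottomRows-block2 : bottomRows {r₁} {r₂} (block2 U V W Z) ≋ hcat W Z
    bottomRows-block2 a j rewrite splitAt-↑ʳ r₁ r₂ a with splitAt s₁ j
    ... | inj₁ _ = refl
    ... | inj₂ _ = refl

    hcat-⊗-block2 : ∀ {t} (P : Matrix t r₁) (Q : Matrix t r₂) →
      (hcat P Q ⊗ block2 U V W Z) ≋ hcat ((P ⊗ U) ⊕ (Q ⊗ W)) ((P ⊗ V) ⊕ (Q ⊗ Z))
    hcat-⊗-block2 P Q = begin
      hcat P Q ⊗ block2 U V W Z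
        ≈⟨ hcat-⊗ P Q (block2 U V W Z) ⟩
      (P ⊗ topRows (block2 U V W Z)) ⊕ (Q ⊗ bottomRows (block2 U V W Z))
        ≈⟨ ⊕-cong (⊗-congʳ P topRows-block2) (⊗-congʳ Q bottomRows-block2) ⟩
      (P ⊗ hcat U V) ⊕ (Q ⊗ hcat W Z)
        ≈⟨ ⊕-cong (⊗-hcat P U V) (⊗-hcat Q W Z) ⟩
      hcat (P ⊗ U) (P ⊗ V) ⊕ hcat (Q ⊗ W) (Q ⊗ Z)
        ≈⟨ hcat-⊕ (P ⊗ U) (Q ⊗ W) (P ⊗ V) (Q ⊗ Z) ⟩
      hcat ((P ⊗ U) ⊕ (Q ⊗ W)) ((P ⊗ V) ⊕ (Q ⊗ Z)) ∎
      where open ≋-Reasoning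

  hcat-⊗-diag2 : ∀ {t r₁ r₂} (P : Matrix t r₁) (Q : Matrix t r₂) (U : Matrix r₁ r₁) (V : Matrix r₂ r₂) →
                 (hcat P Q ⊗ diag2 U V) ≋ hcat (P ⊗ U) (Q ⊗ V)
  hcat-⊗-diag2 {r₁ = r₁} P Q U V = begin
    hcat P Q ⊗ diag2 U V                                   ≈⟨ hcat-⊗-block2 U 0M 0M V P Q ⟩
    hcat ((P ⊗ U) ⊕ (Q ⊗ 0M)) ((P ⊗ 0M) ⊕ (Q ⊗ V))       ≈⟨ hcat-cong {s₁ = r₁} (⊕-cong ≋-refl (⊗-zeroʳ Q)) (⊕-cong (⊗-zeroʳ P) ≋-refl) ⟩
    hcat ((P ⊗ U) ⊕ 0M) (0M ⊕ (Q ⊗ V))                     ≈⟨ hcat-cong (⊕-identityʳ (P ⊗ U)) (⊕-identityˡ (Q ⊗ V)) ⟩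
    hcat (P ⊗ U) (Q ⊗ V)                                   ∎
    where open ≋-Reasoning

  hcat-⊗-block2-−I-0 : ∀ {t r} (P Q : Matrix t r) (U V : Matrix r r) →
    (hcat P Q ⊗ block2 U V (-ᴹ I) 0M) ≋ hcat ((P ⊗ U) −ᴹ Q) (P ⊗ V)
  hcat-⊗-block2-−I-0 P Q U V = begin
    hcat P Q ⊗ block2 U V (-ᴹ I) 0M                    ≈⟨ hcat-⊗-block2 U V (-ᴹ I) 0M P Q ⟩
    hcat ((P ⊗ U) ⊕ (Q ⊗ (-ᴹ I))) ((P ⊗ V) ⊕ (Q ⊗ 0M)) ≈⟨ hcat-cong (⊕-cong ≋-refl (⊗-neg-identityʳ Q)) (⊕-cong ≋-refl (⊗-zeroʳ Q)) ⟩
    hcat ((P ⊗ U) −ᴹ Q) ((P ⊗ V) ⊕ 0M)                 ≈⟨ hcat-cong ≋-refl (⊕-identityʳ (P ⊗ V)) ⟩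
    hcat ((P ⊗ U) −ᴹ Q) (P ⊗ V)                        ∎
    where open ≋-Reasoning

  ⊗-diag2-I-−I : ∀ {r s₁ s₂} (M : Matrix r (s₁ + s₂)) →
    (M ⊗ diag2 {s₁} {s₂} I (-ᴹ I)) ≋ hcat (leftCols {s₁ = s₁} {s₂} M) (-ᴹ rightCols {s₁ = s₁} {s₂} M)
  ⊗-diag2-I-−I {s₁ = s₁} {s₂} M = begin
    M ⊗ J                         ≈⟨ ⊗-congˡ (≋-sym (hcat-leftCols-rightCols {s₁ = s₁} M)) J ⟩
    hcat Mˡ Mʳ ⊗ J                ≈⟨ hcat-⊗-diag2 Mˡ Mʳ I (-ᴹ I) ⟩
    hcat (Mˡ ⊗ I) (Mʳ ⊗ (-ᴹ I))   ≈⟨ hcat-cong (⊗-identityʳ Mˡ) (⊗-neg-identityʳ Mʳ) ⟩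
    hcat Mˡ (-ᴹ Mʳ)               ∎
    where
    open ≋-Reasoning
    J = diag2 {s₁} {s₂} I (-ᴹ I)
    Mˡ = leftCols {s₁ = s₁} {s₂} M
    Mʳ = rightCols {s₁ = s₁} {s₂} M

module NonBacktrackingProperties {c ℓ : Level} (𝕂 : CommutativeRing c ℓ) {n m : ℕ} (G : Graph n m) where
  open Graph G
  open Mat 𝕂
  open GraphMatrices G
  open MatrixProperties 𝕂
  open CommutativeRing 𝕂 hiding (zero) renaming (_+_ to _+ᵣ_)
  open import Algebra.Properties.Semiring.Sum semiring using (sum; sum-cong-≋; *-distribˡ-sum)
  open import Algebra.Properties.Ring ring using (-0#≈0#; -1*x≈-x; -‿involutive)

  arc⊎ : Fin m ⊎ Fin m → Fin n × Fin n
  arc⊎ (inj₁ i) = edge i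
  arc⊎ (inj₂ i) = Product.swap (edge i)

  arc≡arc⊎∘splitAt : ∀ e → arc G e ≡ arc⊎ (splitAt m e)
  arc≡arc⊎∘splitAt e with splitAt m e
  ... | inj₁ _ = ≡.refl
  ... | inj₂ _ = ≡.refl

  arc⊎-injective : ∀ {x y} → arc⊎ x ≡ arc⊎ y → x ≡ y
  arc⊎-injective {inj₁ i} {inj₁ j} p = cong inj₁ (distinct i j p)
  arc⊎-injective {inj₁ i} {inj₂ j} p with distinct′ i j p
  ... | ≡.refl = ⊥-elim (loopless i (cong proj₁ p))
  arc⊎-injective {inj₂ i} {inj₁ j} p with distinct′ j i (≡.sym p)
  ... | ≡.refl = ⊥-elim (loopless j (cong proj₂ p))
  arc⊎-injective {inj₂ i} {inj₂ j} p = cong inj₂ (distinct i j (cong Product.swap p))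

  arc-injective : ∀ {e f} → arc G e ≡ arc G f → e ≡ f
  arc-injective {e} {f} p = begin
    e                         ≡⟨ join-splitAt m m e ⟨
    join m m (splitAt m e)    ≡⟨ cong (join m m) (arc⊎-injective {splitAt m e} {splitAt m f} arcs≡) ⟩
    join m m (splitAt m f)    ≡⟨ join-splitAt m m f ⟩
    f                         ∎
    where
    open ≡.≡-Reasoning
    arcs≡ : arc⊎ (splitAt m e) ≡ arc⊎ (splitAt m f)
    arcs≡ = ≡.trans (≡.sym (arc≡arc⊎∘splitAt e)) (≡.trans p (arc≡arc⊎∘splitAt f))

  reverse : Fin (m + m) → Fin (m + m)
  reverse e = join m m (Sum.swap (splitAt m e))

  arc-reverse : ∀ e → arc G (reverse e) ≡ Product.swap (arc G e)
  arc-reverse e = begin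
    arc G (reverse e)                    ≡⟨ arc≡arc⊎∘splitAt (reverse e) ⟩
    arc⊎ (splitAt m (reverse e))         ≡⟨ cong arc⊎ (splitAt-join m m (Sum.swap (splitAt m e))) ⟩
    arc⊎ (Sum.swap (splitAt m e))        ≡⟨ arc⊎-swap (splitAt m e) ⟩
    Product.swap (arc⊎ (splitAt m e))    ≡⟨ cong Product.swap (arc≡arc⊎∘splitAt e) ⟨
    Product.swap (arc G e)               ∎
    where
    open ≡.≡-Reasoning
    arc⊎-swap : ∀ x → arc⊎ (Sum.swap x) ≡ Product.swap (arc⊎ x)
    arc⊎-swap (inj₁ _) = ≡.refl
    arc⊎-swap (inj₂ _) = ≡.refl

  head-reverse : ∀ e → head G (reverse e) ≡ tail G e
  head-reverse e = cong proj₂ (arc-reverse e)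

  tail-reverse : ∀ e → tail G (reverse e) ≡ head G e
  tail-reverse e = cong proj₁ (arc-reverse e)

  -- B = ST − τ

  τ≋select-reverse : τ ≋ select reverse
  τ≋select-reverse e f with head G e ≟ tail G f | tail G e ≟ head G f | reverse e ≟ f
  ... | yes _   | yes _   | yes _       = refl
  ... | yes h≡t | yes t≡h | no e⁻¹≢f    = ⊥-elim (e⁻¹≢f (arc-injective (≡.trans (arc-reverse e) (cong₂ _,_ h≡t t≡h))))
  ... | yes _   | no t≢h  | yes ≡.refl  = ⊥-elim (t≢h (≡.sym (head-reverse e)))
  ... | no h≢t  | _       | yes ≡.refl  = ⊥-elim (h≢t (≡.sym (tail-reverse e)))
  ... | yes _   | no _    | no _        = refl
  ... | no _    | _       | no _        = refl

  B≈δ−τ : ∀ e f → B e f ≈ δ (head G e) (tail G f) - τ e f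
  B≈δ−τ e f with head G e ≟ tail G f | tail G e ≟ head G f
  ... | yes _ | yes _ = sym (-‿inverseʳ 1#)
  ... | yes _ | no _  = sym (trans (+-congˡ -0#≈0#) (+-identityʳ 1#))
  ... | no _  | yes _ = sym (-‿inverseʳ 0#)
  ... | no _  | no _  = sym (-‿inverseʳ 0#)

  ST≋T∘head : ST ≋ (λ e → T (head G e))
  ST≋T∘head = select-⊗ (head G) T

  B≋ST−τ : B ≋ (ST −ᴹ τ)
  B≋ST−τ e f = trans (B≈δ−τ e f) (+-congʳ (sym (ST≋T∘head e f)))

  B⊗X≋T⊗X∘head−X∘reverse : ∀ {t} (X : Matrix (m + m) t) → (B ⊗ X) ≋ ((λ e → (T ⊗ X) (head G e)) −ᴹ (λ e → X (reverse e)))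
  B⊗X≋T⊗X∘head−X∘reverse X = begin
    B ⊗ X                                                  ≈⟨ ⊗-congˡ B≋ST−τ X ⟩
    (ST −ᴹ τ) ⊗ X                                          ≈⟨ ⊗-distribʳ-−ᴹ ST τ X ⟩
    (ST ⊗ X) −ᴹ (τ ⊗ X)                                    ≈⟨ −ᴹ-cong (⊗-congˡ ST≋T∘head X) (⊗-congˡ τ≋select-reverse X) ⟩
    ((λ e → T (head G e)) ⊗ X) −ᴹ (select reverse ⊗ X)     ≈⟨ −ᴹ-cong ≋-refl (select-⊗ reverse X) ⟩
    (λ e → (T ⊗ X) (head G e)) −ᴹ (λ e → X (reverse e))    ∎
    where open ≋-Reasoning

  T⊗S≋A : (T ⊗ S) ≋ A
  T⊗S≋A x y = sum-cong-≋ (λ e → *-congʳ (δ-sym x (tail G e)))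

  T⊗Tᵀ≋D : (T ⊗ transpose T) ≋ D
  T⊗Tᵀ≋D x y = begin
    sum (λ e → δ x (tail G e) * δ y (tail G e)) ≈⟨ sum-cong-≋ (λ e → δ-*-δ x y (tail G e)) ⟩
    sum (λ e → δ x y * δ (tail G e) x)         ≈⟨ *-distribˡ-sum (δ x y) (λ e → δ (tail G e) x) ⟨
    δ x y * deg x                              ∎
    where open ≈-Reasoning

  S∘reverse≋Tᵀ : (λ e → S (reverse e)) ≋ transpose T
  S∘reverse≋Tᵀ e x = trans (reflexive (cong (λ v → δ v x) (head-reverse e))) (δ-sym (tail G e) x)

  Tᵀ∘reverse≋S : (λ e → transpose T (reverse e)) ≋ S
  Tᵀ∘reverse≋S e x = trans (reflexive (cong (δ x) (tail-reverse e))) (δ-sym x (head G e))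

  B⊗S≋S⊗A−Tᵀ : (B ⊗ S) ≋ ((S ⊗ A) −ᴹ transpose T)
  B⊗S≋S⊗A−Tᵀ = begin
    B ⊗ S                                                  ≈⟨ B⊗X≋T⊗X∘head−X∘reverse S ⟩
    (λ e → (T ⊗ S) (head G e)) −ᴹ (λ e → S (reverse e))    ≈⟨ −ᴹ-cong (λ e → T⊗S≋A (head G e)) S∘reverse≋Tᵀ ⟩
    (λ e → A (head G e)) −ᴹ transpose T                    ≈⟨ −ᴹ-cong (≋-sym (select-⊗ (head G) A)) ≋-refl ⟩
    (S ⊗ A) −ᴹ transpose T                                 ∎
    where open ≋-Reasoning

  B⊗Tᵀ≋S⊗[D−I] : (B ⊗ transpose T) ≋ (S ⊗ (D −ᴹ I))
  B⊗Tᵀ≋S⊗[D−I] = begin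
    B ⊗ transpose T                                                          ≈⟨ B⊗X≋T⊗X∘head−X∘reverse (transpose T) ⟩
    (λ e → (T ⊗ transpose T) (head G e)) −ᴹ (λ e → transpose T (reverse e))  ≈⟨ −ᴹ-cong (λ e → T⊗Tᵀ≋D (head G e)) Tᵀ∘reverse≋S ⟩
    (λ e → (D −ᴹ I) (head G e))                                              ≈⟨ select-⊗ (head G) (D −ᴹ I) ⟨
    S ⊗ (D −ᴹ I)                                                             ∎
    where open ≋-Reasoning

  B▸v≈−λv : ∀ {λ′ v} → InEigenspaceτ λ′ v → InNullST v → ∀ e → (B ▸ v) e ≈ - (λ′ * v e)
  B▸v≈−λv {λ′} {v} τv≈λv STv≈0 e = begin
    (B ▸ v) e                   ≈⟨ ▸-congˡ B≋ST−τ v e ⟩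
    ((ST −ᴹ τ) ▸ v) e           ≈⟨ ▸-distrib-−ᴹ ST τ v e ⟩
    (ST ▸ v) e - (τ ▸ v) e      ≈⟨ +-cong (STv≈0 e) (-‿cong (τv≈λv e)) ⟩
    0# - λ′ * v e               ≈⟨ +-identityˡ _ ⟩
    - (λ′ * v e)                ∎
    where open ≈-Reasoning

  B⊗R≋[R₁,−R₂] : ∀ {k₁ k₂} (R : Matrix (m + m) (k₁ + k₂)) →
    (∀ j → InEigenspaceτ (- 1#) (column R (j ↑ˡ k₂)) × InNullST (column R (j ↑ˡ k₂))) →
    (∀ j → InEigenspaceτ 1# (column R (k₁ ↑ʳ j)) × InNullST (column R (k₁ ↑ʳ j))) →
    (B ⊗ R) ≋ hcat (leftCols {s₁ = k₁} {k₂} R) (-ᴹ rightCols {s₁ = k₁} {k₂} R)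
  B⊗R≋[R₁,−R₂] {k₁} {k₂} R R₁∈𝓔₋₁∩Null R₂∈𝓔₁∩Null = begin
    B ⊗ R                   ≈⟨ ⊗-congʳ B (≋-sym (hcat-leftCols-rightCols {s₁ = k₁} R)) ⟩
    B ⊗ hcat R₁ R₂          ≈⟨ ⊗-hcat B R₁ R₂ ⟩
    hcat (B ⊗ R₁) (B ⊗ R₂)  ≈⟨ hcat-cong B⊗R₁≋R₁ B⊗R₂≋−R₂ ⟩
    hcat R₁ (-ᴹ R₂)         ∎
    where
    open ≋-Reasoning
    R₁ = leftCols {s₁ = k₁} {k₂} R
    R₂ = rightCols {s₁ = k₁} {k₂} R
    B⊗R₁≋R₁ : (B ⊗ R₁) ≋ R₁
    B⊗R₁≋R₁ e j = trans (B▸v≈−λv (proj₁ (R₁∈𝓔₋₁∩Null j)) (proj₂ (R₁∈𝓔₋₁∩Null j)) e)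
                        (trans (-‿cong (-1*x≈-x (R₁ e j))) (-‿involutive (R₁ e j)))
    B⊗R₂≋−R₂ : (B ⊗ R₂) ≋ (-ᴹ R₂)
    B⊗R₂≋−R₂ e j = trans (B▸v≈−λv (proj₁ (R₂∈𝓔₁∩Null j)) (proj₂ (R₂∈𝓔₁∩Null j)) e)
                         (-‿cong (*-identityˡ (R₂ e j)))

-- Connectedness and the linear independence of the columns of R (which make X invertible,
-- so that the identity is a similarity) are not needed for the identity itself.
theorem4p2 : {c ℓ : Level} (𝕂 : CommutativeRing c ℓ) {n m : ℕ} (G : Graph n m) →
  Connected G →
  let open Mat 𝕂
      open GraphMatrices G
      k = m ∸ n
  in (R : Matrix (m + m) (k + k)) →
     LinearlyIndependentColumns R →
     (∀ (j : Fin k) → InEigenspaceτ (CommutativeRing.-_ 𝕂 (CommutativeRing.1# 𝕂)) (column R (j ↑ˡ k)) × InNullST (column R (j ↑ˡ k))) →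
     (∀ (j : Fin k) → InEigenspaceτ (CommutativeRing.1# 𝕂) (column R (k ↑ʳ j)) × InNullST (column R (k ↑ʳ j))) →
     let X = hcat (hcat S (transpose T)) R
     in (B ⊗ X) ≋ (X ⊗ diag2 K (diag2 {k} {k} I (-ᴹ I)))
theorem4p2 𝕂 {n} {m} G _ R _ R₁∈𝓔₋₁∩Null R₂∈𝓔₁∩Null = begin
  B ⊗ hcat (hcat S Tᵀ) R                                             ≈⟨ ⊗-hcat B (hcat S Tᵀ) R ⟩
  hcat (B ⊗ hcat S Tᵀ) (B ⊗ R)                                       ≈⟨ hcat-cong (⊗-hcat B S Tᵀ) ≋-refl ⟩
  hcat (hcat (B ⊗ S) (B ⊗ Tᵀ)) (B ⊗ R)
    ≈⟨ hcat-cong (hcat-cong B⊗S≋S⊗A−Tᵀ B⊗Tᵀ≋S⊗[D−I]) (B⊗R≋[R₁,−R₂] R R₁∈𝓔₋₁∩Null R₂∈𝓔₁∩Null) ⟩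
  hcat (hcat ((S ⊗ A) −ᴹ Tᵀ) (S ⊗ (D −ᴹ I))) (hcat R₁ (-ᴹ R₂))
    ≈⟨ hcat-cong (hcat-⊗-block2-−I-0 S Tᵀ A (D −ᴹ I)) (⊗-diag2-I-−I {s₁ = k} R) ⟨
  hcat (hcat S Tᵀ ⊗ K) (R ⊗ J)                                       ≈⟨ hcat-⊗-diag2 (hcat S Tᵀ) R K J ⟨
  hcat (hcat S Tᵀ) R ⊗ diag2 K J                                     ∎
  where
  open Mat 𝕂
  open MatrixProperties 𝕂
  open GraphMatrices G
  open NonBacktrackingProperties 𝕂 G
  open ≋-Reasoning
  k = m ∸ n
  Tᵀ = transpose T
  J = diag2 {k} {k} I (-ᴹ I)
  R₁ = leftCols {s₁ = k} {k} R
  R₂ = rightCols {s₁ = k} {k} R
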